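{- Let $P,Q$ be $\lambda\mu$-terms, $p,p'\in\mathcal T(P)$, and $D,D'$ bags of elements of $\mathcal T(Q)$; let $x$ be a variable and $\gamma,\eta$ names. If any one of the following three conditions holds, then $p=p'$ and $D=D'$: (1) $p\langle D/x\rangle\cap p'\langle D'/x\rangle\neq\emptyset$; (2) $\langle p\rangle_\gamma D\cap\langle p'\rangle_\gamma D'\neq\emptyset$; (3) $\langle{}_\eta|p|\rangle_\gamma D\cap\langle{}_\eta|p'|\rangle_\gamma D'\neq\emptyset$. Here sums are regarded as sets.
   Context: Fix disjoint countably infinite sets of variables and names. $\lambda\mu$-terms: $M::=x\mid\lambda x.M\mid MM\mid\mu\alpha.{}_\beta|M|$, up to renaming of bound variables and names. Resource terms and sums. - Resource terms: $t::=x\mid\lambda x.t\mid t[t_1,\dots,t_n]\mid\mu\alpha.{}_\beta|t|$, with bags finite multisets; $1$ is the empty bag. - Sums are finite sets with idempotent $+$ and empty sum $0$; constructors extend multilinearly, and $0$ annihilates. - A weak composition (w.c.) of a bag $B$ is a tuple of possibly empty bags whose union is $B$. Linear substitution $t\langle B/x\rangle$: - $x\langle[v]/x\rangle=v$, and $x\langle B/x\rangle=0$ otherwise. - For $y\ne x$: $y\langle1/x\rangle=y$, and $y\langle B/x\rangle=0$ if $B\ne1$. - It commutes with $\lambda y$ and with $\mu\alpha.{}_\beta|\cdot|$. - $(t[v_1..v_n])\langle B/x\rangle=\sum_{(B_0..B_n)\text{ w.c. of }B}t\langle B_0/x\rangle[v_i\langle B_i/x\rangle]_i$. Linear named application $\langle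 t\rangle_\alpha B$ (also defined on named terms ${}_\eta|t|$, yielding sets of named terms): - $\langle x\rangle_\alpha1=x$, and $\langle x\rangle_\alpha B=0$ if $B\ne1$. - It commutes with $\lambda y$, and $\langle\mu\gamma.{}_\eta|t|\rangle_\alpha B=\mu\gamma.\langle{}_\eta|t|\rangle_\alpha B$. - $\langle{}_\eta|t|\rangle_\alpha B={}_\eta|\langle t\rangle_\alpha B|$ for $\eta\ne\alpha$, and $\langle{}_\alpha|t|\rangle_\alpha B=\sum_{(B_1,B_2)\text{ w.c.}}{}_\alpha|(\langle t\rangle_\alpha B_1)B_2|$. - $\langle t[v_1..v_n]\rangle_\alpha B=\sum_{(B_0..B_n)}(\langle t\rangle_\alpha B_0)[\langle v_i\rangle_\alpha B_i]_i$. Taylor expansion. - $\mathcal T(x)=\{x\}$, $\mathcal T(\lambda x.M)=\{\lambda x.t\mid t\in\mathcal T(M)\}$, $\mathcal T(\mu\alpha.{}_\beta|M|)=\{\mu\alpha.{}_\beta|t|\mid t\in\mathcal T(M)\}$. - $\mathcal T(MN)=\{t[u_1..u_n]\mid t\in\mathcal T(M),n\ge0,u_i\in\mathcal T(N)\}$. -}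

module Defs where

open import Data.Nat using (ℕ; zero; suc; _<ᵇ_; _≟_)
open import Data.Bool using (if_then_else_)
open import Data.List using (List; []; _∷_; _++_; map; concatMap)
open import Data.List.Relation.Unary.All using (All)
open import Data.List.Membership.Propositional using (_∈_)
open import Data.Product using (_×_; _,_; ∃-syntax)
open import Relation.Nullary using (yes; no)
open import Relation.Binary.PropositionalEquality using (_≡_)

-- Conventions: variables and names are two disjoint sorts, both
-- represented by de Bruijn indices (ℕ), so terms are taken up to
-- renaming of bound variables and names.  `mu β t` stands for
-- μα.{}_β|t| where α is the name of index 0 inside t.

data Term : Set where
  var : ℕ → Term
  lam : Term → Term
  app : Term → Term → Term
  mu  : ℕ → Term → Term

-- resource terms; bags are lists, read as multisets (see _≈_ below)
data RTerm : Set where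
  var : ℕ → RTerm
  lam : RTerm → RTerm
  app : RTerm → List RTerm → RTerm
  mu  : ℕ → RTerm → RTerm

Bag : Set
Bag = List RTerm

-- named resource terms  {}_η|t|
NTerm : Set
NTerm = ℕ × RTerm

mutual
  data _≈_ : RTerm → RTerm → Set where
    var : ∀ {y} → var y ≈ var y
    lam : ∀ {t t'} → t ≈ t' → lam t ≈ lam t'
    app : ∀ {t t' B B'} → t ≈ t' → B ≋ B' → app t B ≈ app t' B'
    mu  : ∀ {β t t'} → t ≈ t' → mu β t ≈ mu β t'

  data _≋_ : Bag → Bag → Set where
    []  : [] ≋ []
    _∷_ : ∀ {u u' B C D} → u ≈ u' → B ≋ (C ++ D) → (u ∷ B) ≋ (C ++ u' ∷ D)

-- Sums: finite sets of resource terms, represented as lists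
-- (membership only matters; + is union, 0 is []).

Sum : Set
Sum = List RTerm

Meets : List RTerm → List RTerm → Set
Meets S S' = ∃[ s ] ∃[ s' ] (s ∈ S × s' ∈ S' × s ≈ s')

MeetsN : List NTerm → List NTerm → Set
MeetsN S S' = ∃[ η ] ∃[ s ] ∃[ s' ] ((η , s) ∈ S × (η , s') ∈ S' × s ≈ s')

mutual
  shiftV : ℕ → RTerm → RTerm
  shiftV c (var y) = var (if y <ᵇ c then y else suc y)
  shiftV c (lam t) = lam (shiftV (suc c) t)
  shiftV c (app t B) = app (shiftV c t) (shiftVs c B)
  shiftV c (mu β t) = mu β (shiftV c t)

  shiftVs : ℕ → Bag → Bag
  shiftVs c [] = []
  shiftVs c (u ∷ B) = shiftV c u ∷ shiftVs c B

mutual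
  shiftN : ℕ → RTerm → RTerm
  shiftN c (var y) = var y
  shiftN c (lam t) = lam (shiftN c t)
  shiftN c (app t B) = app (shiftN c t) (shiftNs c B)
  shiftN c (mu β t) = mu (if β <ᵇ suc c then β else suc β) (shiftN (suc c) t)

  shiftNs : ℕ → Bag → Bag
  shiftNs c [] = []
  shiftNs c (u ∷ B) = shiftN c u ∷ shiftNs c B

-- Weak compositions of a bag into two parts (B₁ , B₂): every element
-- goes to exactly one side.  A weak composition into n+1 parts is
-- obtained by iterating this (see substBag / nappBag).

splits : Bag → List (Bag × Bag)
splits [] = ([] , []) ∷ []
splits (b ∷ B) = concatMap (λ { (l , r) → (b ∷ l , r) ∷ (l , b ∷ r) ∷ [] }) (splits B)

appS : Sum → List Bag → Sum
appS S Bs = concatMap (λ t → map (app t) Bs) S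

consS : Sum → List Bag → List Bag
consS S Bs = concatMap (λ u → map (u ∷_) Bs) S

mutual
  lsubst : RTerm → ℕ → Bag → Sum
  lsubst (var y) x B with y ≟ x
  lsubst (var y) x (v ∷ []) | yes _ = v ∷ []
  lsubst (var y) x _        | yes _ = []
  lsubst (var y) x []       | no _  = var y ∷ []
  lsubst (var y) x (_ ∷ _)  | no _  = []
  lsubst (lam t) x B = map lam (lsubst t (suc x) (shiftVs 0 B))
  lsubst (mu β t) x B = map (mu β) (lsubst t x (shiftNs 0 B))
  lsubst (app t vs) x B =
    concatMap (λ { (B₀ , R) → appS (lsubst t x B₀) (lsubstBag vs x R) }) (splits B)

  lsubstBag : Bag → ℕ → Bag → List Bag
  lsubstBag [] x [] = [] ∷ []
  lsubstBag [] x (_ ∷ _) = []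
  lsubstBag (v ∷ vs) x B =
    concatMap (λ { (B₁ , R) → consS (lsubst v x B₁) (lsubstBag vs x R) }) (splits B)

mutual
  napp : RTerm → ℕ → Bag → Sum
  napp (var y) α [] = var y ∷ []
  napp (var y) α (_ ∷ _) = []
  napp (lam t) α B = map lam (napp t α (shiftVs 0 B))
  napp (mu η t) α B =
    map (λ { (η' , t') → mu η' t' }) (nnapp η t (suc α) (shiftNs 0 B))
  napp (app t vs) α B =
    concatMap (λ { (B₀ , R) → appS (napp t α B₀) (nappBag vs α R) }) (splits B)

  nappBag : Bag → ℕ → Bag → List Bag
  nappBag [] α [] = [] ∷ []
  nappBag [] α (_ ∷ _) = []
  nappBag (v ∷ vs) α B =
    concatMap (λ { (B₁ , R) → consS (napp v α B₁) (nappBag vs α R) }) (splits B)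

  nnapp : ℕ → RTerm → ℕ → Bag → List NTerm
  nnapp η t α B with η ≟ α
  ... | no _ = map (η ,_) (napp t α B)
  ... | yes _ =
    concatMap (λ { (B₁ , B₂) → map (λ t' → (α , app t' B₂)) (napp t α B₁) }) (splits B)

-- Taylor expansion, as a membership relation  t ∈𝒯 M

data _∈𝒯_ : RTerm → Term → Set where
  var : ∀ {y} → var y ∈𝒯 var y
  lam : ∀ {t M} → t ∈𝒯 M → lam t ∈𝒯 lam M
  mu  : ∀ {β t M} → t ∈𝒯 M → mu β t ∈𝒯 mu β M
  app : ∀ {t M N us} → t ∈𝒯 M → All (_∈𝒯 N) us → app t us ∈𝒯 app M N

-- Every element of p⟨D/x⟩ (of ⟨p⟩_γ D) keeps the skeleton of p and places
-- the resources of D at the occurrences of x (at the arguments of γ).  Since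
-- p and p' lie in 𝒯(P), they share the skeleton of P, so by induction on P a
-- common element determines p and, for each subterm, the sub-bag of D it
-- received; D is the multiset union of these sub-bags.  The only non-local
-- case is an application t[v₁..vₙ], where the elements of the two output
-- bags are matched through multiset equality, i.e. a permutation followed by
-- pointwise ≈, and each match is traced back to an argument vᵢ.
module Submission where

open import Defs
open import Data.Nat using (ℕ; zero; suc; pred; _<ᵇ_; _≟_)
open import Data.Bool using (true; false; if_then_else_)
open import Data.List using (List; []; _∷_; _++_; map; concatMap)
open import Data.List.Properties using (concatMap-cong)
open import Data.List.Relation.Unary.Any using (here; there)
open import Data.List.Relation.Unary.All using (All; []; _∷_)
open import Data.List.Relation.Unary.All.Properties using () renaming (++⁺ to All-++⁺; ++⁻ to All-++⁻)
open import Data.List.Membership.Propositional using (_∈_; find; lose)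
open import Data.List.Membership.Propositional.Properties
  using (∈-map⁺; ∈-map⁻; ∈-concatMap⁺; ∈-concatMap⁻; ∈-∃++)
open import Data.List.Relation.Binary.Permutation.Propositional
  using (_↭_; refl; prep; swap; trans; ↭-sym; ↭-trans)
open import Data.List.Relation.Binary.Permutation.Propositional.Properties
  using (shift; shifts; drop-mid; ∈-resp-↭; ↭-empty-inv; ++⁺; ++⁺ˡ)
open import Data.List.Relation.Binary.Pointwise using (Pointwise; []; _∷_)
  renaming (++⁺ to Pointwise-++⁺)
open import Data.Product using (_×_; _,_; ∃-syntax)
open import Data.Sum using (_⊎_; inj₁; inj₂)
open import Function using (_∘_)
open import Relation.Nullary using (yes; no)
open import Relation.Binary.PropositionalEquality
  using (_≡_; refl; sym; cong; cong₂; subst; subst₂)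

∈-concatMap-∃ : ∀ {X Y : Set} (f : X → List Y) {xs y} →
  y ∈ concatMap f xs → ∃[ x ] (x ∈ xs × y ∈ f x)
∈-concatMap-∃ f = find ∘ ∈-concatMap⁻ f

∈-concatMap-intro : ∀ {X Y : Set} (f : X → List Y) {x xs y} →
  x ∈ xs → y ∈ f x → y ∈ concatMap f xs
∈-concatMap-intro f x∈ y∈ = ∈-concatMap⁺ f (lose x∈ y∈)

∈-appS⁻ : ∀ S Bs {s} → s ∈ appS S Bs → ∃[ t ] ∃[ vs ] (t ∈ S × vs ∈ Bs × s ≡ app t vs)
∈-appS⁻ S Bs s∈ with t , t∈ , s∈t ← ∈-concatMap-∃ (λ t → map (app t) Bs) {S} s∈
                 with vs , vs∈ , refl ← ∈-map⁻ (app t) s∈t = t , vs , t∈ , vs∈ , refl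

∈-consS⁻ : ∀ S Bs {us} → us ∈ consS S Bs → ∃[ u ] ∃[ vs ] (u ∈ S × vs ∈ Bs × us ≡ u ∷ vs)
∈-consS⁻ S Bs us∈ with u , u∈ , us∈u ← ∈-concatMap-∃ (λ u → map (u ∷_) Bs) {S} us∈
                  with vs , vs∈ , refl ← ∈-map⁻ (u ∷_) us∈u = u , vs , u∈ , vs∈ , refl

∈-consS⁺ : ∀ {S} Bs {u vs} → u ∈ S → vs ∈ Bs → (u ∷ vs) ∈ consS S Bs
∈-consS⁺ Bs u∈ vs∈ = ∈-concatMap-intro (λ u → map (u ∷_) Bs) u∈ (∈-map⁺ (_ ∷_) vs∈)

splits-↭ : ∀ B {B₁ B₂} → (B₁ , B₂) ∈ splits B → B ↭ B₁ ++ B₂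
splits-↭ [] (here refl) = refl
splits-↭ (b ∷ B) ∈sp with ∈-concatMap-∃ _ {splits B} ∈sp
... | (l , r) , ∈spB , here refl = prep b (splits-↭ B ∈spB)
... | (l , r) , ∈spB , there (here refl) = ↭-trans (prep b (splits-↭ B ∈spB)) (↭-sym (shift b l r))

[]-∈-splits : ∀ B → ([] , B) ∈ splits B
[]-∈-splits [] = here refl
[]-∈-splits (b ∷ B) = ∈-concatMap-intro _ ([]-∈-splits B) (there (here refl))

++-∈-splits : ∀ B₁ B₂ → (B₁ , B₂) ∈ splits (B₁ ++ B₂)
++-∈-splits [] B₂ = []-∈-splits B₂
++-∈-splits (b ∷ B₁) B₂ = ∈-concatMap-intro _ (++-∈-splits B₁ B₂) (here refl)

-- Multiset equality as a permutation followed by pointwise ≈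

module _ {X : Set} {R : X → X → Set} where

  Pointwise-++⁻ˡ : ∀ A {B C} → Pointwise R (A ++ B) C →
    ∃[ C₁ ] ∃[ C₂ ] (C ≡ C₁ ++ C₂ × Pointwise R A C₁ × Pointwise R B C₂)
  Pointwise-++⁻ˡ [] AB~C = [] , _ , refl , [] , AB~C
  Pointwise-++⁻ˡ (a ∷ A) (a~c ∷ AB~C) with C₁ , C₂ , refl , A~C₁ , B~C₂ ← Pointwise-++⁻ˡ A AB~C =
    _ ∷ C₁ , C₂ , refl , a~c ∷ A~C₁ , B~C₂

  Pointwise-++⁻ʳ : ∀ {A} C {D} → Pointwise R A (C ++ D) →
    ∃[ A₁ ] ∃[ A₂ ] (A ≡ A₁ ++ A₂ × Pointwise R A₁ C × Pointwise R A₂ D)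
  Pointwise-++⁻ʳ [] A~CD = [] , _ , refl , [] , A~CD
  Pointwise-++⁻ʳ (c ∷ C) (a~c ∷ A~CD) with A₁ , A₂ , refl , A₁~C , A₂~D ← Pointwise-++⁻ʳ C A~CD =
    _ ∷ A₁ , A₂ , refl , a~c ∷ A₁~C , A₂~D

  Pointwise-↭ : ∀ {A C C'} → Pointwise R A C → C ↭ C' → ∃[ A' ] (A ↭ A' × Pointwise R A' C')
  Pointwise-↭ A~C refl = _ , refl , A~C
  Pointwise-↭ (a~c ∷ A~C) (prep _ C↭C') with A' , A↭A' , A'~C' ← Pointwise-↭ A~C C↭C' =
    _ , prep _ A↭A' , a~c ∷ A'~C'
  Pointwise-↭ (a~c ∷ b~d ∷ A~C) (swap _ _ C↭C') with A' , A↭A' , A'~C' ← Pointwise-↭ A~C C↭C' =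
    _ , swap _ _ A↭A' , b~d ∷ a~c ∷ A'~C'
  Pointwise-↭ A~C (trans C↭C' C'↭C'') with A' , A↭A' , A'~C' ← Pointwise-↭ A~C C↭C'
                                        with A'' , A'↭A'' , A''~C'' ← Pointwise-↭ A'~C' C'↭C'' =
    A'' , ↭-trans A↭A' A'↭A'' , A''~C''

_≋ₚ_ : Bag → Bag → Set
B ≋ₚ C = ∃[ M ] (B ↭ M × Pointwise _≈_ M C)

≋⇒≋ₚ : ∀ {B C} → B ≋ C → B ≋ₚ C
≋⇒≋ₚ [] = [] , refl , []
≋⇒≋ₚ (_∷_ {u = u} {C = C} u≈u' B≋CD) with M , B↭M , M~CD ← ≋⇒≋ₚ B≋CD
                                      with M₁ , M₂ , refl , M₁~C , M₂~D ← Pointwise-++⁻ʳ C M~CD =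
  M₁ ++ u ∷ M₂ , ↭-trans (prep u B↭M) (↭-sym (shift u M₁ M₂)) , Pointwise-++⁺ M₁~C (u≈u' ∷ M₂~D)

≋ₚ⇒≋ : ∀ B {C} → B ≋ₚ C → B ≋ C
≋ₚ⇒≋ [] (M , []↭M , M~C) with refl ← ↭-empty-inv (↭-sym []↭M) | [] ← M~C = []
≋ₚ⇒≋ (b ∷ B) (M , bB↭M , M~C) with M₁ , M₂ , refl ← ∈-∃++ (∈-resp-↭ bB↭M (here refl))
                              with C₁ , _ , refl , M₁~C₁ , b≈c ∷ M₂~C₂ ← Pointwise-++⁻ˡ M₁ M~C =
  b≈c ∷ ≋ₚ⇒≋ B (_ , drop-mid [] M₁ bB↭M , Pointwise-++⁺ M₁~C₁ M₂~C₂)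

≋-via-↭ : ∀ {B B₁ B₂ C C₁ C₂} →
  B ↭ B₁ ++ B₂ → B₁ ≋ C₁ → B₂ ≋ C₂ → C ↭ C₁ ++ C₂ → B ≋ C
≋-via-↭ {B} B↭ B₁≋C₁ B₂≋C₂ C↭
  with M₁ , B₁↭M₁ , M₁~C₁ ← ≋⇒≋ₚ B₁≋C₁ | M₂ , B₂↭M₂ , M₂~C₂ ← ≋⇒≋ₚ B₂≋C₂
  with M , M₁M₂↭M , M~C ← Pointwise-↭ (Pointwise-++⁺ M₁~C₁ M₂~C₂) (↭-sym C↭) =
  ≋ₚ⇒≋ B (M , ↭-trans B↭ (↭-trans (++⁺ B₁↭M₁ B₂↭M₂) M₁M₂↭M) , M~C)

-- Left inverse of the index shift  y ↦ if y <ᵇ c then y else suc y ; its value at c is junk.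
unshiftIdx : ℕ → ℕ → ℕ
unshiftIdx zero y = pred y
unshiftIdx (suc c) zero = zero
unshiftIdx (suc c) (suc y) = suc (unshiftIdx c y)

unshiftIdx-shift : ∀ c y → unshiftIdx c (if y <ᵇ c then y else suc y) ≡ y
unshiftIdx-shift zero y = refl
unshiftIdx-shift (suc c) zero = refl
unshiftIdx-shift (suc c) (suc y) with y <ᵇ c | unshiftIdx-shift c y
... | true  | eq = cong suc eq
... | false | eq = cong suc eq

mutual
  unshiftV : ℕ → RTerm → RTerm
  unshiftV c (var y) = var (unshiftIdx c y)
  unshiftV c (lam t) = lam (unshiftV (suc c) t)
  unshiftV c (app t B) = app (unshiftV c t) (unshiftVs c B)
  unshiftV c (mu β t) = mu β (unshiftV c t)

  unshiftVs : ℕ → Bag → Bag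
  unshiftVs c [] = []
  unshiftVs c (u ∷ B) = unshiftV c u ∷ unshiftVs c B

mutual
  unshiftN : ℕ → RTerm → RTerm
  unshiftN c (var y) = var y
  unshiftN c (lam t) = lam (unshiftN c t)
  unshiftN c (app t B) = app (unshiftN c t) (unshiftNs c B)
  unshiftN c (mu β t) = mu (unshiftIdx (suc c) β) (unshiftN (suc c) t)

  unshiftNs : ℕ → Bag → Bag
  unshiftNs c [] = []
  unshiftNs c (u ∷ B) = unshiftN c u ∷ unshiftNs c B

mutual
  unshiftV-shiftV : ∀ c t → unshiftV c (shiftV c t) ≡ t
  unshiftV-shiftV c (var y) = cong var (unshiftIdx-shift c y)
  unshiftV-shiftV c (lam t) = cong lam (unshiftV-shiftV (suc c) t)
  unshiftV-shiftV c (app t B) = cong₂ app (unshiftV-shiftV c t) (unshiftVs-shiftVs c B)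
  unshiftV-shiftV c (mu β t) = cong (mu β) (unshiftV-shiftV c t)

  unshiftVs-shiftVs : ∀ c B → unshiftVs c (shiftVs c B) ≡ B
  unshiftVs-shiftVs c [] = refl
  unshiftVs-shiftVs c (u ∷ B) = cong₂ _∷_ (unshiftV-shiftV c u) (unshiftVs-shiftVs c B)

mutual
  unshiftN-shiftN : ∀ c t → unshiftN c (shiftN c t) ≡ t
  unshiftN-shiftN c (var y) = refl
  unshiftN-shiftN c (lam t) = cong lam (unshiftN-shiftN c t)
  unshiftN-shiftN c (app t B) = cong₂ app (unshiftN-shiftN c t) (unshiftNs-shiftNs c B)
  unshiftN-shiftN c (mu β t) = cong₂ mu (unshiftIdx-shift (suc c) β) (unshiftN-shiftN (suc c) t)

  unshiftNs-shiftNs : ∀ c B → unshiftNs c (shiftNs c B) ≡ B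
  unshiftNs-shiftNs c [] = refl
  unshiftNs-shiftNs c (u ∷ B) = cong₂ _∷_ (unshiftN-shiftN c u) (unshiftNs-shiftNs c B)

unshiftVs-++ : ∀ c A B → unshiftVs c (A ++ B) ≡ unshiftVs c A ++ unshiftVs c B
unshiftVs-++ c [] B = refl
unshiftVs-++ c (a ∷ A) B = cong (unshiftV c a ∷_) (unshiftVs-++ c A B)

unshiftNs-++ : ∀ c A B → unshiftNs c (A ++ B) ≡ unshiftNs c A ++ unshiftNs c B
unshiftNs-++ c [] B = refl
unshiftNs-++ c (a ∷ A) B = cong (unshiftN c a ∷_) (unshiftNs-++ c A B)

mutual
  unshiftV-cong : ∀ c {t t'} → t ≈ t' → unshiftV c t ≈ unshiftV c t'
  unshiftV-cong c var = var
  unshiftV-cong c (lam t≈t') = lam (unshiftV-cong (suc c) t≈t')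
  unshiftV-cong c (app t≈t' B≋B') = app (unshiftV-cong c t≈t') (unshiftVs-cong c B≋B')
  unshiftV-cong c (mu t≈t') = mu (unshiftV-cong c t≈t')

  unshiftVs-cong : ∀ c {B B'} → B ≋ B' → unshiftVs c B ≋ unshiftVs c B'
  unshiftVs-cong c [] = []
  unshiftVs-cong c (_∷_ {u' = u'} {C = C} {D = D} u≈u' B≋CD) =
    subst (_ ≋_) (sym (unshiftVs-++ c C (u' ∷ D)))
      (unshiftV-cong c u≈u' ∷ subst (_ ≋_) (unshiftVs-++ c C D) (unshiftVs-cong c B≋CD))

mutual
  unshiftN-cong : ∀ c {t t'} → t ≈ t' → unshiftN c t ≈ unshiftN c t'
  unshiftN-cong c var = var
  unshiftN-cong c (lam t≈t') = lam (unshiftN-cong c t≈t')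
  unshiftN-cong c (app t≈t' B≋B') = app (unshiftN-cong c t≈t') (unshiftNs-cong c B≋B')
  unshiftN-cong c (mu t≈t') = mu (unshiftN-cong (suc c) t≈t')

  unshiftNs-cong : ∀ c {B B'} → B ≋ B' → unshiftNs c B ≋ unshiftNs c B'
  unshiftNs-cong c [] = []
  unshiftNs-cong c (_∷_ {u' = u'} {C = C} {D = D} u≈u' B≋CD) =
    subst (_ ≋_) (sym (unshiftNs-++ c C (u' ∷ D)))
      (unshiftN-cong c u≈u' ∷ subst (_ ≋_) (unshiftNs-++ c C D) (unshiftNs-cong c B≋CD))

shiftVs-reflects-≋ : ∀ c {B B'} → shiftVs c B ≋ shiftVs c B' → B ≋ B'
shiftVs-reflects-≋ c {B} {B'} =
  subst₂ _≋_ (unshiftVs-shiftVs c B) (unshiftVs-shiftVs c B') ∘ unshiftVs-cong c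

shiftNs-reflects-≋ : ∀ c {B B'} → shiftNs c B ≋ shiftNs c B' → B ≋ B'
shiftNs-reflects-≋ c {B} {B'} =
  subst₂ _≋_ (unshiftNs-shiftNs c B) (unshiftNs-shiftNs c B') ∘ unshiftNs-cong c

-- Multilinear extension to applications of a linear operator F

module Multilinear (F : RTerm → Bag → Sum) where

  bagF : Bag → Bag → List Bag
  bagF [] [] = [] ∷ []
  bagF [] (_ ∷ _) = []
  bagF (v ∷ vs) B = concatMap (λ { (B₁ , R) → consS (F v B₁) (bagF vs R) }) (splits B)

  appF : RTerm → Bag → Bag → Sum
  appF t vs B = concatMap (λ { (B₀ , R) → appS (F t B₀) (bagF vs R) }) (splits B)

  Separating : Term → Set
  Separating N = ∀ {u u'} B B' → u ∈𝒯 N → u' ∈𝒯 N → Meets (F u B) (F u' B') → u ≈ u' × B ≋ B'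

  ∈-bagF-∷⁻ : ∀ v vs R {ws} → ws ∈ bagF (v ∷ vs) R →
    ∃[ B₁ ] ∃[ R₀ ] ∃[ w ] ∃[ ws₀ ]
      (R ↭ B₁ ++ R₀ × ws ≡ w ∷ ws₀ × w ∈ F v B₁ × ws₀ ∈ bagF vs R₀)
  ∈-bagF-∷⁻ v vs R ws∈ with (B₁ , R₀) , ∈sp , ∈cons ← ∈-concatMap-∃ _ {splits R} ws∈
                       with w , ws₀ , w∈ , ws₀∈ , refl ← ∈-consS⁻ (F v B₁) (bagF vs R₀) ∈cons =
    B₁ , R₀ , w , ws₀ , splits-↭ R ∈sp , refl , w∈ , ws₀∈

  ∈-bagF-∷⁺ : ∀ {v} vs B₁ R₀ {w ws} → w ∈ F v B₁ → ws ∈ bagF vs R₀ →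
    (w ∷ ws) ∈ bagF (v ∷ vs) (B₁ ++ R₀)
  ∈-bagF-∷⁺ vs B₁ R₀ w∈ ws∈ = ∈-concatMap-intro _ (++-∈-splits B₁ R₀) (∈-consS⁺ (bagF vs R₀) w∈ ws∈)

  []-∈-bagF : ∀ vs R → [] ∈ bagF vs R → vs ≡ [] × R ≡ []
  []-∈-bagF [] [] _ = refl , refl
  []-∈-bagF (v ∷ vs) R []∈ with _ , _ , _ , _ , _ , () , _ ← ∈-bagF-∷⁻ v vs R []∈

  bagF-pick : ∀ C {w E} vs R → (C ++ w ∷ E) ∈ bagF vs R →
    ∃[ vc ] ∃[ u' ] ∃[ ve ] ∃[ Rw ] ∃[ Rr ]
      (vs ≡ vc ++ u' ∷ ve × w ∈ F u' Rw × (C ++ E) ∈ bagF (vc ++ ve) Rr × R ↭ Rw ++ Rr)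
  bagF-pick [] [] [] (here ())
  bagF-pick (_ ∷ _) [] [] (here ())
  bagF-pick _ [] [] (there ())
  bagF-pick [] (v ∷ vs) R ws∈ with B₁ , R₀ , _ , _ , R↭ , refl , w∈ , ws₀∈ ← ∈-bagF-∷⁻ v vs R ws∈ =
    [] , v , vs , B₁ , R₀ , refl , w∈ , ws₀∈ , R↭
  bagF-pick (c ∷ C) (v ∷ vs) R ws∈
    with B₁ , R₀ , _ , _ , R↭ , refl , c∈ , ws₀∈ ← ∈-bagF-∷⁻ v vs R ws∈
    with vc , u' , ve , Rw , Rr , refl , w∈ , rest∈ , R₀↭ ← bagF-pick C vs R₀ ws₀∈ =
    v ∷ vc , u' , ve , Rw , B₁ ++ Rr , refl , w∈ , ∈-bagF-∷⁺ (vc ++ ve) B₁ Rr c∈ rest∈ ,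
    ↭-trans R↭ (↭-trans (++⁺ˡ B₁ R₀↭) (shifts B₁ Rw))

  bagF-separating : ∀ {N} → Separating N → ∀ {vs vs' R R' ws ws'} →
    All (_∈𝒯 N) vs → All (_∈𝒯 N) vs' → ws ∈ bagF vs R → ws' ∈ bagF vs' R' → ws ≋ ws' →
    vs ≋ vs' × R ≋ R'
  bagF-separating sep {[]} {vs'} {[]} {R'} [] _ (here refl) ws'∈ []
    with refl , refl ← []-∈-bagF vs' R' ws'∈ = [] , []
  bagF-separating sep {v ∷ vs} {R = R} _ _ ws∈ _ [] with () , _ ← []-∈-bagF (v ∷ vs) R ws∈
  bagF-separating sep {v ∷ vs} {vs'} {R} {R'} (v∈ ∷ vs∈) vs'∈ ws∈ ws'∈ (_∷_ {C = C} w≈w' ws≋)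
    with B₁ , R₀ , w , _ , R↭ , refl , w∈ , ws₀∈ ← ∈-bagF-∷⁻ v vs R ws∈
    with vc , u' , ve , Rw , Rr , refl , w'∈ , ws₀'∈ , R'↭ ← bagF-pick C vs' R' ws'∈
    with vc∈ , u'∈ ∷ ve∈ ← All-++⁻ vc vs'∈
    with v≈u' , B₁≋Rw ← sep B₁ Rw v∈ u'∈ (w , _ , w∈ , w'∈ , w≈w')
    with vs≋ , R₀≋Rr ← bagF-separating sep vs∈ (All-++⁺ vc∈ ve∈) ws₀∈ ws₀'∈ ws≋ =
    v≈u' ∷ vs≋ , ≋-via-↭ R↭ B₁≋Rw R₀≋Rr R'↭

  appF-separating : ∀ {M N} → Separating M → Separating N → ∀ {t t' vs vs'} B B' →
    t ∈𝒯 M → t' ∈𝒯 M → All (_∈𝒯 N) vs → All (_∈𝒯 N) vs' →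
    Meets (appF t vs B) (appF t' vs' B') → app t vs ≈ app t' vs' × B ≋ B'
  appF-separating sepM sepN {t} {t'} {vs} {vs'} B B' t∈ t'∈ vs∈ vs'∈ (s , s' , s∈ , s'∈ , s≈s')
    with (B₀ , R) , ∈sp , ∈app ← ∈-concatMap-∃ _ {splits B} s∈
       | (B₀' , R') , ∈sp' , ∈app' ← ∈-concatMap-∃ _ {splits B'} s'∈
    with h , ws , ∈F , ∈bagF , refl ← ∈-appS⁻ (F t B₀) (bagF vs R) ∈app
       | h' , ws' , ∈F' , ∈bagF' , refl ← ∈-appS⁻ (F t' B₀') (bagF vs' R') ∈app'
    with app h≈h' ws≋ws' ← s≈s'
    with t≈t' , B₀≋ ← sepM B₀ B₀' t∈ t'∈ (h , h' , ∈F , ∈F' , h≈h')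
       | vs≋ , R≋ ← bagF-separating sepN vs∈ vs'∈ ∈bagF ∈bagF' ws≋ws' =
    app t≈t' vs≋ , ≋-via-↭ (splits-↭ B ∈sp) B₀≋ R≋ (splits-↭ B' ∈sp')

open Multilinear using (Separating; bagF; appF; appF-separating)

lsubstBag≡bagF : ∀ x vs R → lsubstBag vs x R ≡ bagF (λ u B → lsubst u x B) vs R
lsubstBag≡bagF x [] [] = refl
lsubstBag≡bagF x [] (_ ∷ _) = refl
lsubstBag≡bagF x (v ∷ vs) R =
  concatMap-cong (λ { (B₁ , R₀) → cong (consS (lsubst v x B₁)) (lsubstBag≡bagF x vs R₀) }) (splits R)

lsubst-app≡appF : ∀ x t vs B → lsubst (app t vs) x B ≡ appF (λ u B → lsubst u x B) t vs B
lsubst-app≡appF x t vs B =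
  concatMap-cong (λ { (B₀ , R) → cong (appS (lsubst t x B₀)) (lsubstBag≡bagF x vs R) }) (splits B)

nappBag≡bagF : ∀ α vs R → nappBag vs α R ≡ bagF (λ u B → napp u α B) vs R
nappBag≡bagF α [] [] = refl
nappBag≡bagF α [] (_ ∷ _) = refl
nappBag≡bagF α (v ∷ vs) R =
  concatMap-cong (λ { (B₁ , R₀) → cong (consS (napp v α B₁)) (nappBag≡bagF α vs R₀) }) (splits R)

napp-app≡appF : ∀ α t vs B → napp (app t vs) α B ≡ appF (λ u B → napp u α B) t vs B
napp-app≡appF α t vs B =
  concatMap-cong (λ { (B₀ , R) → cong (appS (napp t α B₀)) (nappBag≡bagF α vs R) }) (splits B)

lsubst-var-separating : ∀ y x D D' → Meets (lsubst (var y) x D) (lsubst (var y) x D') → D ≋ D'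
lsubst-var-separating y x D D' m with y ≟ x
lsubst-var-separating y x (v ∷ []) (v' ∷ []) (_ , _ , here refl , here refl , v≈v') | yes _ =
  _∷_ {C = []} v≈v' []
lsubst-var-separating y x [] [] _ | no _ = []
lsubst-var-separating y x [] _ (_ , _ , () , _) | yes _
lsubst-var-separating y x (_ ∷ _ ∷ _) _ (_ , _ , () , _) | yes _
lsubst-var-separating y x (_ ∷ []) [] (_ , _ , _ , () , _) | yes _
lsubst-var-separating y x (_ ∷ []) (_ ∷ _ ∷ _) (_ , _ , _ , () , _) | yes _
lsubst-var-separating y x (_ ∷ _) _ (_ , _ , () , _) | no _
lsubst-var-separating y x [] (_ ∷ _) (_ , _ , _ , () , _) | no _

lsubst-separating : ∀ P x → Separating (λ u B → lsubst u x B) P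
lsubst-separating (var y) x D D' var var m = var , lsubst-var-separating y x D D' m
lsubst-separating (lam M) x D D' (lam {t} t∈) (lam {t'} t'∈) (_ , _ , s∈ , s'∈ , s≈s')
  with s₀ , s₀∈ , refl ← ∈-map⁻ lam s∈ | s₀' , s₀'∈ , refl ← ∈-map⁻ lam s'∈
  with lam s₀≈s₀' ← s≈s'
  with t≈t' , D≋ ← lsubst-separating M (suc x) (shiftVs 0 D) (shiftVs 0 D') t∈ t'∈
                     (s₀ , s₀' , s₀∈ , s₀'∈ , s₀≈s₀') =
  lam t≈t' , shiftVs-reflects-≋ 0 D≋
lsubst-separating (mu β M) x D D' (mu t∈) (mu t'∈) (_ , _ , s∈ , s'∈ , s≈s')
  with s₀ , s₀∈ , refl ← ∈-map⁻ (mu β) s∈ | s₀' , s₀'∈ , refl ← ∈-map⁻ (mu β) s'∈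
  with mu s₀≈s₀' ← s≈s'
  with t≈t' , D≋ ← lsubst-separating M x (shiftNs 0 D) (shiftNs 0 D') t∈ t'∈
                     (s₀ , s₀' , s₀∈ , s₀'∈ , s₀≈s₀') =
  mu t≈t' , shiftNs-reflects-≋ 0 D≋
lsubst-separating (app M N) x D D' (app {t} {us = us} t∈ us∈) (app {t'} {us = us'} t'∈ us'∈)
  (s , s' , s∈ , s'∈ , s≈s') =
  appF-separating _ (lsubst-separating M x) (lsubst-separating N x) D D' t∈ t'∈ us∈ us'∈
    (s , s' , subst (s ∈_) (lsubst-app≡appF x t us D) s∈ ,
              subst (s' ∈_) (lsubst-app≡appF x t' us' D') s'∈ , s≈s')

mutual
  napp-separating : ∀ P α → Separating (λ u B → napp u α B) P
  napp-separating (var y) α [] [] var var _ = var , []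
  napp-separating (var y) α (_ ∷ _) _ var var (_ , _ , () , _)
  napp-separating (var y) α [] (_ ∷ _) var var (_ , _ , _ , () , _)
  napp-separating (lam M) α D D' (lam {t} t∈) (lam {t'} t'∈) (_ , _ , s∈ , s'∈ , s≈s')
    with s₀ , s₀∈ , refl ← ∈-map⁻ lam s∈ | s₀' , s₀'∈ , refl ← ∈-map⁻ lam s'∈
    with lam s₀≈s₀' ← s≈s'
    with t≈t' , D≋ ← napp-separating M α (shiftVs 0 D) (shiftVs 0 D') t∈ t'∈
                       (s₀ , s₀' , s₀∈ , s₀'∈ , s₀≈s₀') =
    lam t≈t' , shiftVs-reflects-≋ 0 D≋
  napp-separating (mu η M) α D D' (mu t∈) (mu t'∈) (_ , _ , s∈ , s'∈ , s≈s')
    with (n , s₀) , s₀∈ , refl ← ∈-map⁻ _ s∈ | (n' , s₀') , s₀'∈ , refl ← ∈-map⁻ _ s'∈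
    with mu s₀≈s₀' ← s≈s'
    with t≈t' , D≋ ← nnapp-separating M η (suc α) (shiftNs 0 D) (shiftNs 0 D') t∈ t'∈
                       (n , s₀ , s₀' , s₀∈ , s₀'∈ , s₀≈s₀') =
    mu t≈t' , shiftNs-reflects-≋ 0 D≋
  napp-separating (app M N) α D D' (app {t} {us = us} t∈ us∈) (app {t'} {us = us'} t'∈ us'∈)
    (s , s' , s∈ , s'∈ , s≈s') =
    appF-separating _ (napp-separating M α) (napp-separating N α) D D' t∈ t'∈ us∈ us'∈
      (s , s' , subst (s ∈_) (napp-app≡appF α t us D) s∈ ,
                subst (s' ∈_) (napp-app≡appF α t' us' D') s'∈ , s≈s')

  nnapp-separating : ∀ P η α {p p'} D D' → p ∈𝒯 P → p' ∈𝒯 P →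
    MeetsN (nnapp η p α D) (nnapp η p' α D') → p ≈ p' × D ≋ D'
  nnapp-separating P η α {p} {p'} D D' p∈ p'∈ m with η ≟ α
  nnapp-separating P η α {p} {p'} D D' p∈ p'∈ (_ , _ , _ , s∈ , s'∈ , s≈s') | no _
    with s₀ , s₀∈ , refl ← ∈-map⁻ _ s∈ | s₀' , s₀'∈ , refl ← ∈-map⁻ _ s'∈ =
    napp-separating P α D D' p∈ p'∈ (s₀ , s₀' , s₀∈ , s₀'∈ , s≈s')
  nnapp-separating P η α {p} {p'} D D' p∈ p'∈ (_ , _ , _ , s∈ , s'∈ , s≈s') | yes _
    with (B₁ , B₂) , ∈sp , ∈B₁ ← ∈-concatMap-∃ _ {splits D} s∈
       | (B₁' , B₂') , ∈sp' , ∈B₁' ← ∈-concatMap-∃ _ {splits D'} s'∈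
    with h , h∈ , refl ← ∈-map⁻ _ ∈B₁ | h' , h'∈ , refl ← ∈-map⁻ _ ∈B₁'
    with app h≈h' B₂≋ ← s≈s'
    with p≈p' , B₁≋ ← napp-separating P α B₁ B₁' p∈ p'∈ (h , h' , h∈ , h'∈ , h≈h') =
    p≈p' , ≋-via-↭ (splits-↭ D ∈sp) B₁≋ B₂≋ (splits-↭ D' ∈sp')

lemma3p5 : (P Q : Term) (p p' : RTerm) (D D' : Bag) (x γ η : ℕ) →
    p ∈𝒯 P → p' ∈𝒯 P → All (_∈𝒯 Q) D → All (_∈𝒯 Q) D' →
    (Meets (lsubst p x D) (lsubst p' x D')
      ⊎ Meets (napp p γ D) (napp p' γ D')
      ⊎ MeetsN (nnapp η p γ D) (nnapp η p' γ D')) →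
    (p ≈ p') × (D ≋ D')
lemma3p5 P Q p p' D D' x γ η p∈ p'∈ _ _ (inj₁ m) = lsubst-separating P x D D' p∈ p'∈ m
lemma3p5 P Q p p' D D' x γ η p∈ p'∈ _ _ (inj₂ (inj₁ m)) = napp-separating P γ D D' p∈ p'∈ m
lemma3p5 P Q p p' D D' x γ η p∈ p'∈ _ _ (inj₂ (inj₂ m)) = nnapp-separating P η γ D D' p∈ p'∈ m
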